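{- Let $G$ be a strictly chordal graph. Then every critical clique of $G$ is either (1) the set of all simplicial vertices of some maximal clique of $G$, or (2) the set of all vertices of some minimal vertex separator of $G$.
   Context: All graphs are finite, simple and connected. Two vertices $u,v$ are true twins if $N[u]=N[v]$, where $N[v]$ is the closed neighbourhood. A vertex is simplicial if its neighbourhood is a clique. A block graph is a connected graph in which every block is a clique; a graph is strictly chordal if it is obtained from a block graph by adding zero or more true twins to each vertex. For non-adjacent vertices $u,v$, a set $S\subset V$ is a $uv$-separator if $u$ and $v$ lie in different connected components of $G-S$; it is a minimal $uv$-separator if no proper subset of $S$ is a $uv$-separator; a minimal vertex separator is a set that is a minimal $uv$-separator for some pair of non-adjacent vertices $u,v$. A critical clique of $G$ is a maximal set of vertices that are pairwise true twins. -}

module Defs where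

open import Data.Nat using (ℕ)
open import Data.Fin using (Fin)
open import Data.Fin.Subset using (Subset; _∈_; _∉_; _⊆_; _⊂_; ∁; _-_)
open import Data.Product using (Σ; _×_; ∃; ∃-syntax)
open import Data.Sum using (_⊎_)
open import Relation.Nullary using (¬_; Dec)
open import Relation.Binary.PropositionalEquality using (_≡_; _≢_)
open import Function.Bundles using (_⇔_)

record Graph (n : ℕ) : Set₁ where
  field
    Adj     : Fin n → Fin n → Set
    adj-dec : ∀ u v → Dec (Adj u v)
    sym     : ∀ {u v} → Adj u v → Adj v u
    irrefl  : ∀ {u} → ¬ Adj u u
open Graph public

module _ {n : ℕ} (G : Graph n) where

  data Reach (X : Subset n) : Fin n → Fin n → Set where
    here : ∀ {u} → u ∈ X → Reach X u u
    step : ∀ {u w v} → u ∈ X → Adj G u w → Reach X w v → Reach X u v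

  ConnectedOn : Subset n → Set
  ConnectedOn X = ∀ {u v} → u ∈ X → v ∈ X → Reach X u v

  Connected : Set
  Connected = ∀ u v → Reach (∁ Data.Fin.Subset.⊥) u v

  Clique : Subset n → Set
  Clique X = ∀ {u v} → u ∈ X → v ∈ X → u ≢ v → Adj G u v

  MaximalClique : Subset n → Set
  MaximalClique K = Clique K × (∀ K′ → Clique K′ → K ⊆ K′ → K′ ⊆ K)

  Biconnected : Subset n → Set
  Biconnected B = ConnectedOn B × (∀ {x} → x ∈ B → ConnectedOn (B - x))

  -- A block: a maximal connected subgraph without a cut vertex
  -- (a maximal such subgraph is induced, so we describe it by its vertex set;
  --  we require it to be nonempty).
  Block : Subset n → Set
  Block B = (∃[ x ] x ∈ B) × Biconnected B × (∀ B′ → Biconnected B′ → B ⊆ B′ → B′ ⊆ B)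

  IsBlockGraph : Set
  IsBlockGraph = Connected × (∀ B → Block B → Clique B)

  InClosedNbhd : Fin n → Fin n → Set
  InClosedNbhd u w = (w ≡ u) ⊎ Adj G u w

  TrueTwins : Fin n → Fin n → Set
  TrueTwins u v = ∀ w → InClosedNbhd u w ⇔ InClosedNbhd v w

  Simplicial : Fin n → Set
  Simplicial v = ∀ {a b} → Adj G v a → Adj G v b → a ≢ b → Adj G a b

  IsSimplicialPartOf : Subset n → Subset n → Set
  IsSimplicialPartOf C K = ∀ v → (v ∈ C) ⇔ (v ∈ K × Simplicial v)

  PairwiseTwins : Subset n → Set
  PairwiseTwins C = ∀ {u v} → u ∈ C → v ∈ C → TrueTwins u v

  CriticalClique : Subset n → Set
  CriticalClique C = PairwiseTwins C × (∀ D → PairwiseTwins D → C ⊆ D → D ⊆ C)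

  Separator : Fin n → Fin n → Subset n → Set
  Separator u v S = u ∉ S × v ∉ S × ¬ Reach (∁ S) u v

  MinimalSeparator : Fin n → Fin n → Subset n → Set
  MinimalSeparator u v S = Separator u v S × (∀ T → T ⊂ S → ¬ Separator u v T)

  MinimalVertexSeparator : Subset n → Set
  MinimalVertexSeparator S =
    ∃[ u ] ∃[ v ] (u ≢ v × ¬ Adj G u v × MinimalSeparator u v S)

-- G is strictly chordal: obtained from a block graph H by replacing each vertex of H
-- by a nonempty set of true twins, via a surjective map f : V(G) → V(H) such that
-- distinct u, v are adjacent iff f u = f v or f u ~ f v in H.
StrictlyChordal : ∀ {n} → Graph n → Set₁
StrictlyChordal {n} G =
  Σ ℕ λ m → Σ (Graph m) λ H → Σ (Fin n → Fin m) λ f →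
    IsBlockGraph H ×
    (∀ y → ∃[ x ] f x ≡ y) ×
    (∀ u v → u ≢ v → Adj G u v ⇔ (f u ≡ f v ⊎ Adj H (f u) (f v)))

module Submission where

-- If c lies in C and is simplicial, C is the simplicial part of the maximal clique N[c].
-- Otherwise c has non-adjacent neighbours a, b; every vertex of C is a twin of c and so a
-- common neighbour of a and b, which makes C a minimal ab-separator once it separates them
-- at all. It does: an a–b path avoiding C projects to a path between the neighbours f a, f b
-- of f c in the block graph avoiding f c, and closing it up through f c gives a cycle, which
-- lies in a single block; blocks are cliques, so f a ~ f b and hence a ~ b.

open import Defs
open import Data.Bool.Properties using (T-≡)
open import Data.Fin using (Fin; _≟_)
open import Data.Fin.Properties using (any?)
open import Data.Fin.Subset using (Subset; _∈_; _∉_; _⊆_; _⊂_; _⊃_; ∁; _-_; _─_; _∪_; ⁅_⁆; inside; outside; Nonempty; Empty)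
open import Data.Fin.Subset.Properties using (x∈⁅x⁆; x∈⁅y⁆⇒x≡y; x∉p⇒x∈∁p; x∈∁p⇒x∉p; _∈?_; nonempty?; x∈p∧x∉q⇒x∈p─q; p─q⊆p; x∈p∪q⁺; x∈p∪q⁻)
open import Data.Fin.Subset.Induction using (⊃-wellFounded; Acc; acc)
open import Data.Nat using (ℕ)
open import Data.Product using (Σ; _×_; _,_; proj₁; proj₂; ∃-syntax)
open import Data.Empty using (⊥-elim)
open import Data.Sum using (_⊎_; inj₁; inj₂)
open import Data.Unit using (⊤; tt)
open import Data.Vec using (tabulate; _∷_; here; there)
open import Data.Vec.Properties using (lookup∘tabulate; lookup⇒[]=; []=⇒lookup)
open import Function.Base using (_∘_; id)
open import Function.Bundles using (_⇔_; mk⇔; Equivalence)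
open import Level using (0ℓ)
open import Relation.Binary.PropositionalEquality using (_≡_; _≢_; refl; subst) renaming (sym to ≡-sym; trans to ≡-trans)
open import Relation.Nullary using (¬_; Dec; yes; no; isYes)
open import Relation.Nullary.Decidable using (¬¬-excluded-middle; decidable-stable; _⊎-dec_; _×-dec_; ¬?; toWitness; fromWitness)
open import Relation.Unary using (Pred; Decidable)

open Equivalence using (to; from)

private
  variable
    n : ℕ

setOf : {P : Pred (Fin n) 0ℓ} → Decidable P → Subset n
setOf P? = tabulate (isYes ∘ P?)

∈-setOf⁺ : {P : Pred (Fin n) 0ℓ} (P? : Decidable P) {x : Fin n} → P x → x ∈ setOf P?
∈-setOf⁺ P? {x} px =
  lookup⇒[]= x _ (≡-trans (lookup∘tabulate (isYes ∘ P?) x) (to T-≡ (fromWitness {a? = P? x} px)))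

∈-setOf⁻ : {P : Pred (Fin n) 0ℓ} (P? : Decidable P) {x : Fin n} → x ∈ setOf P? → P x
∈-setOf⁻ P? {x} x∈ =
  toWitness {a? = P? x} (from T-≡ (≡-trans (≡-sym (lookup∘tabulate (isYes ∘ P?) x)) ([]=⇒lookup x∈)))

x∈p─q⇒x∉q : {x : Fin n} (p q : Subset n) → x ∈ p ─ q → x ∉ q
x∈p─q⇒x∉q (_ ∷ p) (outside ∷ q) (there x∈) (there x∈q) = x∈p─q⇒x∉q p q x∈ x∈q
x∈p─q⇒x∉q (_ ∷ p) (inside ∷ q) (there x∈) (there x∈q) = x∈p─q⇒x∉q p q x∈ x∈q

x∈p-y⁺ : {x y : Fin n} {p : Subset n} → x ∈ p → x ≢ y → x ∈ p - y
x∈p-y⁺ {y = y} x∈p x≢y = x∈p∧x∉q⇒x∈p─q x∈p (x≢y ∘ x∈⁅y⁆⇒x≡y y)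

x∈p-y⇒x∈p : {x y : Fin n} {p : Subset n} → x ∈ p - y → x ∈ p
x∈p-y⇒x∈p {y = y} {p} = p─q⊆p p ⁅ y ⁆

x∈p-y⇒x≢y : {x y : Fin n} {p : Subset n} → x ∈ p - y → x ≢ y
x∈p-y⇒x≢y {y = y} {p} x∈ refl = x∈p─q⇒x∉q p ⁅ y ⁆ x∈ (x∈⁅x⁆ y)

module _ (G : Graph n) where

  reach-source : ∀ {X u v} → Reach G X u v → u ∈ X
  reach-source (here u∈X)     = u∈X
  reach-source (step u∈X _ _) = u∈X

  reach-target : ∀ {X u v} → Reach G X u v → v ∈ X
  reach-target (here v∈X)   = v∈X
  reach-target (step _ _ r) = reach-target r

  reach-trans : ∀ {X u v w} → Reach G X u v → Reach G X v w → Reach G X u w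
  reach-trans (here _)       r′ = r′
  reach-trans (step u∈X a r) r′ = step u∈X a (reach-trans r r′)

  reach-sym : ∀ {X u v} → Reach G X u v → Reach G X v u
  reach-sym (here u∈X)     = here u∈X
  reach-sym (step u∈X a r) = reach-trans (reach-sym r) (step (reach-source r) (sym G a) (here u∈X))

  connectedOn-hub : ∀ {X} y → (∀ {u} → u ∈ X → Reach G X u y) → ConnectedOn G X
  connectedOn-hub _ toY u∈X v∈X = reach-trans (toY u∈X) (reach-sym (toY v∈X))

  data Path : Fin n → Fin n → Set where
    end  : ∀ {u} → Path u u
    cons : ∀ {u w v} → Adj G u w → Path w v → Path u v

  OnPath : ∀ {u v} → Path u v → Fin n → Set
  OnPath (end {u})      z = z ≡ u
  OnPath (cons {u} _ P) z = z ≡ u ⊎ OnPath P z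

  onPath? : ∀ {u v} (P : Path u v) → Decidable (OnPath P)
  onPath? (end {u})      z = z ≟ u
  onPath? (cons {u} _ P) z = (z ≟ u) ⊎-dec onPath? P z

  Simple : ∀ {u v} → Path u v → Set
  Simple end            = ⊤
  Simple (cons {u} _ P) = ¬ OnPath P u × Simple P

  source-on-path : ∀ {u v} (P : Path u v) → OnPath P u
  source-on-path end        = refl
  source-on-path (cons _ _) = inj₁ refl

  target-on-path : ∀ {u v} (P : Path u v) → OnPath P v
  target-on-path end        = refl
  target-on-path (cons _ P) = inj₂ (target-on-path P)

  suffix : ∀ {w v u} (P : Path w v) → OnPath P u →
           Σ (Path u v) λ Q → (∀ {z} → OnPath Q z → OnPath P z) × (Simple P → Simple Q)
  suffix end        refl       = end , id , id
  suffix (cons a P) (inj₁ refl) = cons a P , id , id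
  suffix (cons a P) (inj₂ u∈P) with suffix P u∈P
  ... | Q , Q⊆P , simple = Q , inj₂ ∘ Q⊆P , simple ∘ proj₂

  reach⇒simple-path : ∀ {X u v} → Reach G X u v →
                      Σ (Path u v) λ P → Simple P × (∀ {z} → OnPath P z → z ∈ X)
  reach⇒simple-path (here u∈X) = end , tt , λ { refl → u∈X }
  reach⇒simple-path {u = u} (step u∈X a r) with reach⇒simple-path r
  ... | P , simple , P⊆X with onPath? P u
  ...   | yes u∈P = let Q , Q⊆P , simpleQ = suffix P u∈P in Q , simpleQ simple , P⊆X ∘ Q⊆P
  ...   | no u∉P  = cons a P , (u∉P , simple) , λ { (inj₁ refl) → u∈X ; (inj₂ z∈P) → P⊆X z∈P }

  path⇒reach-target : ∀ {X u v} (P : Path u v) → (∀ {z} → OnPath P z → z ∈ X) →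
                      ∀ {z} → OnPath P z → Reach G X z v
  path⇒reach-target end        P⊆X refl        = here (P⊆X refl)
  path⇒reach-target (cons a P) P⊆X (inj₁ refl) =
    step (P⊆X (inj₁ refl)) a (path⇒reach-target P (P⊆X ∘ inj₂) (source-on-path P))
  path⇒reach-target (cons a P) P⊆X (inj₂ z∈P) = path⇒reach-target P (P⊆X ∘ inj₂) z∈P

  simple-path-minus : ∀ {X u v} (P : Path u v) → Simple P → ∀ y →
                      (∀ {z} → OnPath P z → z ≢ y → z ∈ X) →
                      ∀ {z} → OnPath P z → z ≢ y → Reach G X z v ⊎ Reach G X u z
  simple-path-minus end _ y P⊆X refl z≢y = inj₂ (here (P⊆X refl z≢y))
  simple-path-minus (cons {u} a P) (u∉P , simple) y P⊆X z∈P z≢y with u ≟ y | z∈P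
  ... | yes refl | inj₁ refl = ⊥-elim (z≢y refl)
  ... | yes refl | inj₂ z∈P′ =
    inj₁ (path⇒reach-target P (λ t∈P → P⊆X (inj₂ t∈P) λ { refl → u∉P t∈P }) z∈P′)
  ... | no u≢y | inj₁ refl = inj₂ (here (P⊆X (inj₁ refl) z≢y))
  ... | no u≢y | inj₂ z∈P′ with simple-path-minus P simple y (P⊆X ∘ inj₂) z∈P′ z≢y
  ...   | inj₁ r = inj₁ r
  ...   | inj₂ r = inj₂ (step (P⊆X (inj₁ refl) u≢y) a r)

  module Cycle {x p q} (x~p : Adj G x p) (x~q : Adj G x q) (P : Path p q) (simple : Simple P)
               (x∉P : ∀ {z} → OnPath P z → z ≢ x) where

    vertices : Subset n
    vertices = setOf λ z → (z ≟ x) ⊎-dec onPath? P z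

    x∈vertices : x ∈ vertices
    x∈vertices = ∈-setOf⁺ _ (inj₁ refl)

    P⊆vertices : ∀ {z} → OnPath P z → z ∈ vertices
    P⊆vertices z∈P = ∈-setOf⁺ _ (inj₂ z∈P)

    connected : ConnectedOn G vertices
    connected = connectedOn-hub x λ u∈ → case (∈-setOf⁻ _ u∈)
      where
      case : ∀ {u} → u ≡ x ⊎ OnPath P u → Reach G vertices u x
      case (inj₁ refl) = here x∈vertices
      case (inj₂ u∈P)  = reach-trans (path⇒reach-target P P⊆vertices u∈P)
                                     (step (P⊆vertices (target-on-path P)) (sym G x~q) (here x∈vertices))

    connected-minus-x : ConnectedOn G (vertices - x)
    connected-minus-x = connectedOn-hub q λ u∈ → case u∈ (∈-setOf⁻ _ (x∈p-y⇒x∈p u∈))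
      where
      P⊆vertices-x : ∀ {z} → OnPath P z → z ∈ vertices - x
      P⊆vertices-x z∈P = x∈p-y⁺ (P⊆vertices z∈P) (x∉P z∈P)
      case : ∀ {u} → u ∈ vertices - x → u ≡ x ⊎ OnPath P u → Reach G (vertices - x) u q
      case u∈ (inj₁ refl) = ⊥-elim (x∈p-y⇒x≢y u∈ refl)
      case u∈ (inj₂ u∈P)  = path⇒reach-target P P⊆vertices-x u∈P

    connected-minus-P : ∀ {y} → OnPath P y → ConnectedOn G (vertices - y)
    connected-minus-P {y} y∈P = connectedOn-hub x λ u∈ → case u∈ (∈-setOf⁻ _ (x∈p-y⇒x∈p u∈))
      where
      x∈vertices-y : x ∈ vertices - y
      x∈vertices-y = x∈p-y⁺ x∈vertices λ { refl → x∉P y∈P refl }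
      case : ∀ {u} → u ∈ vertices - y → u ≡ x ⊎ OnPath P u → Reach G (vertices - y) u x
      case u∈ (inj₁ refl) = here x∈vertices-y
      case u∈ (inj₂ u∈P) with simple-path-minus P simple y (x∈p-y⁺ ∘ P⊆vertices) u∈P (x∈p-y⇒x≢y u∈)
      ... | inj₁ u⇝q = reach-trans u⇝q (step (reach-target u⇝q) (sym G x~q) (here x∈vertices-y))
      ... | inj₂ p⇝u = reach-trans (reach-sym p⇝u) (step (reach-source p⇝u) (sym G x~p) (here x∈vertices-y))

    biconnected : Biconnected G vertices
    biconnected = connected , λ y∈ → case (∈-setOf⁻ _ y∈)
      where
      case : ∀ {y} → y ≡ x ⊎ OnPath P y → ConnectedOn G (vertices - y)
      case (inj₁ refl) = connected-minus-x
      case (inj₂ y∈P)  = connected-minus-P y∈P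

  unextendable⇒block : ∀ {B} → Nonempty B → Biconnected G B →
                       ¬ (∃[ B′ ] (Biconnected G B′ × B ⊂ B′)) → Block G B
  unextendable⇒block {B} ne bc ¬larger = ne , bc , maximal
    where
    maximal : ∀ B′ → Biconnected G B′ → B ⊆ B′ → B′ ⊆ B
    maximal B′ bc′ B⊆B′ {y} y∈B′ with y ∈? B
    ... | yes y∈B = y∈B
    ... | no  y∉B = ⊥-elim (¬larger (B′ , bc′ , B⊆B′ , y , y∈B′ , y∉B))

  -- Whether B has a strictly larger biconnected superset is not decided here, so we only get
  -- the double negation, by induction along the well-founded _⊃_.
  biconnected⊆block : ∀ B → Nonempty B → Biconnected G B → ¬ ¬ (∃[ B′ ] (Block G B′ × B ⊆ B′))
  biconnected⊆block B = go B (⊃-wellFounded B)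
    where
    go : ∀ B → Acc _⊃_ B → Nonempty B → Biconnected G B → ¬ ¬ (∃[ B′ ] (Block G B′ × B ⊆ B′))
    go B (acc rec) (z , z∈B) bc ¬block =
      ¬¬-excluded-middle {A = ∃[ B′ ] (Biconnected G B′ × B ⊂ B′)} λ where
        (yes (B′ , bc′ , B⊂B′)) →
          go B′ (rec B⊂B′) (z , proj₁ B⊂B′ z∈B) bc′
             λ (B″ , block , B′⊆B″) → ¬block (B″ , block , B′⊆B″ ∘ proj₁ B⊂B′)
        (no ¬larger) → ¬block (B , unextendable⇒block (z , z∈B) bc ¬larger , id)

  block-graph-common-neighbours : IsBlockGraph G → ∀ {x p q} → Adj G x p → Adj G x q → p ≢ q →
                                  Reach G (∁ ⁅ x ⁆) p q → Adj G p q
  block-graph-common-neighbours (_ , clique) {x} {p} {q} x~p x~q p≢q p⇝q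
    with reach⇒simple-path p⇝q
  ... | P , simple , P⊆∁x =
    decidable-stable (adj-dec G p q) λ p≁q →
      biconnected⊆block vertices (x , x∈vertices) biconnected
        λ (B , block , cycle⊆B) →
          p≁q (clique B block (cycle⊆B (P⊆vertices (source-on-path P)))
                              (cycle⊆B (P⊆vertices (target-on-path P))) p≢q)
    where
    x∉P : ∀ {z} → OnPath P z → z ≢ x
    x∉P z∈P refl = x∈∁p⇒x∉p (P⊆∁x z∈P) (x∈⁅x⁆ x)
    open Cycle x~p x~q P simple x∉P

  twin-refl : ∀ {u} → TrueTwins G u u
  twin-refl _ = mk⇔ id id

  twin-sym : ∀ {u v} → TrueTwins G u v → TrueTwins G v u
  twin-sym t w = mk⇔ (from (t w)) (to (t w))

  twin-trans : ∀ {u v w} → TrueTwins G u v → TrueTwins G v w → TrueTwins G u w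
  twin-trans t s z = mk⇔ (to (s z) ∘ to (t z)) (from (t z) ∘ from (s z))

  twin-adj : ∀ {u v w} → TrueTwins G u v → InClosedNbhd G u w → w ≢ v → Adj G v w
  twin-adj {w = w} t w∈N[u] w≢v with to (t w) w∈N[u]
  ... | inj₁ w≡v = ⊥-elim (w≢v w≡v)
  ... | inj₂ v~w = v~w

  adj⇒≢ : ∀ {u v} → Adj G u v → u ≢ v
  adj⇒≢ u~v refl = irrefl G u~v

  critical-clique-absorbs : ∀ {C w} → CriticalClique G C → (∀ {c} → c ∈ C → TrueTwins G c w) → w ∈ C
  critical-clique-absorbs {C} {w} (twins , maximal) twin-of-C =
    maximal (C ∪ ⁅ w ⁆) twins′ (x∈p∪q⁺ ∘ inj₁) (x∈p∪q⁺ (inj₂ (x∈⁅x⁆ w)))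
    where
    twin-of-w : ∀ {u} → u ∈ C ∪ ⁅ w ⁆ → TrueTwins G u w
    twin-of-w u∈ with x∈p∪q⁻ C ⁅ w ⁆ u∈
    ... | inj₁ u∈C = twin-of-C u∈C
    ... | inj₂ u∈w rewrite x∈⁅y⁆⇒x≡y w u∈w = twin-refl
    twins′ : PairwiseTwins G (C ∪ ⁅ w ⁆)
    twins′ u∈ v∈ = twin-trans (twin-of-w u∈) (twin-sym (twin-of-w v∈))

  empty-critical-clique⇒no-vertices : ∀ {C} → CriticalClique G C → Empty C → ¬ Fin n
  empty-critical-clique⇒no-vertices cc empty w =
    empty (w , critical-clique-absorbs cc λ c∈C → ⊥-elim (empty (_ , c∈C)))

  simplicial-neighbourhood : ∀ {c a b} → Simplicial G c → InClosedNbhd G c a → InClosedNbhd G c b →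
                             a ≢ b → Adj G a b
  simplicial-neighbourhood s (inj₁ refl) (inj₁ refl) a≢b = ⊥-elim (a≢b refl)
  simplicial-neighbourhood s (inj₁ refl) (inj₂ c~b)  _   = c~b
  simplicial-neighbourhood s (inj₂ c~a)  (inj₁ refl) _   = sym G c~a
  simplicial-neighbourhood s (inj₂ c~a)  (inj₂ c~b)  a≢b = s c~a c~b a≢b

  simplicial⇒closedNbhd⊆ : ∀ {u v} → Simplicial G u → Adj G u v →
                           ∀ {w} → InClosedNbhd G u w → InClosedNbhd G v w
  simplicial⇒closedNbhd⊆ {v = v} s u~v {w} w∈N[u] with w ≟ v
  ... | yes w≡v = inj₁ w≡v
  ... | no  w≢v = inj₂ (simplicial-neighbourhood s (inj₂ u~v) w∈N[u] (w≢v ∘ ≡-sym))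

  adjacent-simplicial⇒twins : ∀ {u v} → Simplicial G u → Simplicial G v → Adj G u v → TrueTwins G u v
  adjacent-simplicial⇒twins su sv u~v _ =
    mk⇔ (simplicial⇒closedNbhd⊆ su u~v) (simplicial⇒closedNbhd⊆ sv (sym G u~v))

  closedNbhd : Fin n → Subset n
  closedNbhd c = setOf λ w → (w ≟ c) ⊎-dec adj-dec G c w

  simplicial⇒maximal-clique : ∀ {c} → Simplicial G c → MaximalClique G (closedNbhd c)
  simplicial⇒maximal-clique {c} s = clique , maximal
    where
    clique : Clique G (closedNbhd c)
    clique u∈ v∈ = simplicial-neighbourhood s (∈-setOf⁻ _ u∈) (∈-setOf⁻ _ v∈)
    maximal : ∀ K → Clique G K → closedNbhd c ⊆ K → K ⊆ closedNbhd c
    maximal K K-clique N[c]⊆K {w} w∈K with w ≟ c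
    ... | yes w≡c = ∈-setOf⁺ _ (inj₁ w≡c)
    ... | no  w≢c = ∈-setOf⁺ _ (inj₂ (K-clique (N[c]⊆K (∈-setOf⁺ _ (inj₁ refl))) w∈K (w≢c ∘ ≡-sym)))

  critical-clique-simplicial-part : ∀ {C c} → CriticalClique G C → c ∈ C → Simplicial G c →
                                    IsSimplicialPartOf G C (closedNbhd c)
  critical-clique-simplicial-part {C} {c} cc@(twins , _) c∈C s v = mk⇔ into onto
    where
    into : v ∈ C → v ∈ closedNbhd c × Simplicial G v
    into v∈C = ∈-setOf⁺ _ (to (t _) (inj₁ refl)) ,
               λ v~a v~b a≢b → simplicial-neighbourhood s (to (t _) (inj₂ v~a)) (to (t _) (inj₂ v~b)) a≢b
      where
      t : TrueTwins G v c
      t = twins v∈C c∈C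
    onto : v ∈ closedNbhd c × Simplicial G v → v ∈ C
    onto (v∈N[c] , sv) with ∈-setOf⁻ _ v∈N[c]
    ... | inj₁ refl = c∈C
    ... | inj₂ c~v  = critical-clique-absorbs cc λ c′∈C →
                        twin-trans (twins c′∈C c∈C) (adjacent-simplicial⇒twins s sv c~v)

  NonadjacentNeighbours : Fin n → Fin n → Fin n → Set
  NonadjacentNeighbours c a b = Adj G c a × Adj G c b × a ≢ b × ¬ Adj G a b

  simplicial⊎nonadjacent-neighbours : ∀ c → Simplicial G c ⊎ ∃[ a ] ∃[ b ] NonadjacentNeighbours c a b
  simplicial⊎nonadjacent-neighbours c with any? (λ a → any? (nonadjacent? a))
    where
    nonadjacent? : ∀ a b → Dec (NonadjacentNeighbours c a b)
    nonadjacent? a b = adj-dec G c a ×-dec adj-dec G c b ×-dec ¬? (a ≟ b) ×-dec ¬? (adj-dec G a b)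
  ... | yes witness = inj₂ witness
  ... | no none = inj₁ λ {a} {b} c~a c~b a≢b →
    decidable-stable (adj-dec G a b) λ a≁b → none (a , b , c~a , c~b , a≢b , a≁b)

  common-neighbours⇒minimal-separator : ∀ {a b S} → (∀ {s} → s ∈ S → Adj G a s × Adj G s b) →
                                        Separator G a b S → MinimalSeparator G a b S
  common-neighbours⇒minimal-separator common sep = sep , λ where
    T (_ , s , s∈S , s∉T) (a∉T , b∉T , ¬a⇝b) →
      ¬a⇝b (step (x∉p⇒x∈∁p a∉T) (proj₁ (common s∈S))
             (step (x∉p⇒x∈∁p s∉T) (proj₂ (common s∈S)) (here (x∉p⇒x∈∁p b∉T))))

  nonadjacent-neighbours∉critical-clique : ∀ {C c a b} → CriticalClique G C → c ∈ C →
                                           NonadjacentNeighbours c a b → a ∉ C × b ∉ C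
  nonadjacent-neighbours∉critical-clique (twins , _) c∈C (c~a , c~b , a≢b , a≁b) =
    (λ a∈C → a≁b (twin-adj (twins c∈C a∈C) (inj₂ c~b) (a≢b ∘ ≡-sym))) ,
    (λ b∈C → a≁b (sym G (twin-adj (twins c∈C b∈C) (inj₂ c~a) a≢b)))

  critical-clique-minimal-separator : ∀ {C c a b} → CriticalClique G C → c ∈ C →
                                      NonadjacentNeighbours c a b → ¬ Reach G (∁ C) a b →
                                      MinimalVertexSeparator G C
  critical-clique-minimal-separator {C} {c} {a} {b} cc@(twins , _) c∈C nn@(c~a , c~b , a≢b , a≁b) ¬a⇝b =
    a , b , a≢b , a≁b , common-neighbours⇒minimal-separator common (a∉C , b∉C , ¬a⇝b)
    where
    a∉C : a ∉ C
    a∉C = proj₁ (nonadjacent-neighbours∉critical-clique cc c∈C nn)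
    b∉C : b ∉ C
    b∉C = proj₂ (nonadjacent-neighbours∉critical-clique cc c∈C nn)
    common : ∀ {s} → s ∈ C → Adj G a s × Adj G s b
    common s∈C = sym G (twin-adj (twins c∈C s∈C) (inj₂ c~a) λ { refl → a∉C s∈C }) ,
                 twin-adj (twins c∈C s∈C) (inj₂ c~b) λ { refl → b∉C s∈C }

module TwinExpansion {G : Graph n} {m} {H : Graph m} {f : Fin n → Fin m}
                     (adj⇔ : ∀ u v → u ≢ v → Adj G u v ⇔ (f u ≡ f v ⊎ Adj H (f u) (f v))) where

  same-image⇒closedNbhd⊆ : ∀ {u v} → f u ≡ f v → ∀ {w} → InClosedNbhd G u w → InClosedNbhd G v w
  same-image⇒closedNbhd⊆ {u} {v} fu≡fv {w} w∈N[u] with w ≟ v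
  ... | yes w≡v = inj₁ w≡v
  ... | no  w≢v = inj₂ (from (adj⇔ v w (w≢v ∘ ≡-sym)) (image-adj w∈N[u]))
    where
    image-adj : InClosedNbhd G u w → f v ≡ f w ⊎ Adj H (f v) (f w)
    image-adj (inj₁ refl) = inj₁ (≡-sym fu≡fv)
    image-adj (inj₂ u~w) with to (adj⇔ u w (adj⇒≢ G u~w)) u~w
    ... | inj₁ fu≡fw = inj₁ (≡-trans (≡-sym fu≡fv) fu≡fw)
    ... | inj₂ fu~fw = inj₂ (subst (λ y → Adj H y (f w)) fu≡fv fu~fw)

  same-image⇒twins : ∀ {u v} → f u ≡ f v → TrueTwins G u v
  same-image⇒twins fu≡fv _ = mk⇔ (same-image⇒closedNbhd⊆ fu≡fv) (same-image⇒closedNbhd⊆ (≡-sym fu≡fv))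

  reach-image : ∀ {X Y} → (∀ {w} → w ∈ X → f w ∈ Y) → ∀ {u v} → Reach G X u v → Reach H Y (f u) (f v)
  reach-image X→Y (here u∈X) = here (X→Y u∈X)
  reach-image {Y = Y} X→Y {v = v} (step {u} {w} u∈X u~w r) with to (adj⇔ u w (adj⇒≢ G u~w)) u~w
  ... | inj₁ fu≡fw = subst (λ y → Reach H Y y (f v)) (≡-sym fu≡fw) (reach-image X→Y r)
  ... | inj₂ fu~fw = step (X→Y u∈X) fu~fw (reach-image X→Y r)

  critical-clique-separates : IsBlockGraph H → ∀ {C c a b} → CriticalClique G C → c ∈ C →
                              NonadjacentNeighbours G c a b → ¬ Reach G (∁ C) a b
  critical-clique-separates block-graph {C} {c} {a} {b} cc@(twins , _) c∈C nn@(c~a , c~b , a≢b , a≁b) a⇝b =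
    a≁b (from (adj⇔ a b a≢b) (inj₂ (block-graph-common-neighbours H block-graph
                                      (image-adj c~a a∉C) (image-adj c~b b∉C) fa≢fb (reach-image avoid a⇝b))))
    where
    a∉C : a ∉ C
    a∉C = proj₁ (nonadjacent-neighbours∉critical-clique G cc c∈C nn)
    b∉C : b ∉ C
    b∉C = proj₂ (nonadjacent-neighbours∉critical-clique G cc c∈C nn)
    fibre⊆C : ∀ {w} → f w ≡ f c → w ∈ C
    fibre⊆C fw≡fc = critical-clique-absorbs G cc λ c′∈C →
                      twin-trans G (twins c′∈C c∈C) (same-image⇒twins (≡-sym fw≡fc))
    image-adj : ∀ {w} → Adj G c w → w ∉ C → Adj H (f c) (f w)
    image-adj {w} c~w w∉C with to (adj⇔ c w (adj⇒≢ G c~w)) c~w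
    ... | inj₁ fc≡fw = ⊥-elim (w∉C (fibre⊆C (≡-sym fc≡fw)))
    ... | inj₂ fc~fw = fc~fw
    fa≢fb : f a ≢ f b
    fa≢fb = a≁b ∘ from (adj⇔ a b a≢b) ∘ inj₁
    avoid : ∀ {w} → w ∈ ∁ C → f w ∈ ∁ ⁅ f c ⁆
    avoid w∈∁C = x∉p⇒x∈∁p λ fw∈ → x∈∁p⇒x∉p w∈∁C (fibre⊆C (x∈⁅y⁆⇒x≡y _ fw∈))

lemma2 : ∀ {n} (G : Graph n) → StrictlyChordal G → (C : Subset n) → CriticalClique G C →
    (∃[ K ] (MaximalClique G K × IsSimplicialPartOf G C K))
    ⊎ (∃[ S ] (MinimalVertexSeparator G S × C ≡ S))
lemma2 G (_ , H , f , block-graph , _ , adj⇔) C cc with nonempty? C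
... | no C-empty = inj₁ (C , ((λ {u} → ⊥-elim (no-vertex u)) , λ _ _ _ {u} → ⊥-elim (no-vertex u)) ,
                         λ v → ⊥-elim (no-vertex v))
  where
  no-vertex : ¬ Fin _
  no-vertex = empty-critical-clique⇒no-vertices G cc C-empty
... | yes (c , c∈C) with simplicial⊎nonadjacent-neighbours G c
...   | inj₁ simplicial = inj₁ (closedNbhd G c , simplicial⇒maximal-clique G simplicial ,
                                critical-clique-simplicial-part G cc c∈C simplicial)
...   | inj₂ (_ , _ , nn) = inj₂ (C , critical-clique-minimal-separator G cc c∈C nn
                                      (TwinExpansion.critical-clique-separates adj⇔ block-graph cc c∈C nn) , refl)
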